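{- Let $n\geq1$, $d\geq0$, $\nu\vdash n+1$ and $N\in\operatorname{SSYT}_d(\nu)$. If every element $i$ of $\operatorname{Dsp}^c(N)$ satisfies $n>2i$, then $N=\hat\iota M$ for some $\lambda\vdash n$ and $M\in\operatorname{SSYT}_d(\lambda)$. In particular, this holds for every $N\in\operatorname{SSYT}_d(\nu)$ when $n>2d$.
   Context: $\operatorname{SSYT}_d(\lambda)$ is the set of semistandard fillings (rows weakly increasing, columns strictly increasing) of $\lambda$ by non-negative integers with entry sum $d$. For a tableau $N$, $\operatorname{Dsp}^c(N)$ is the multiset consisting, for each integer $h\geq1$ such that some entry of $N$ is at least $h$, of the number of entries of $N$ that are at least $h$. For $M$ of shape $\lambda$, $\hat\iota M$ is the tableau of shape $\lambda$ with one box added to the first row, obtained by shifting every entry of the first row of $M$ one box to the right and putting $0$ in the upper left box. -}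

module Defs where

open import Data.Nat using (ℕ; zero; suc; _+_; _*_; _≤_; _<_; _≥_; _⊔_; _≤?_)
open import Data.Nat.ListAction using (sum)
open import Data.List using (List; []; _∷_; map; length; concat; filter; foldr; upTo)
open import Data.List.Relation.Unary.All using (All)
open import Data.List.Relation.Unary.Linked using (Linked)
open import Data.Product using (_×_)
open import Data.Unit using (⊤)
open import Data.Empty using (⊥)
open import Relation.Binary.PropositionalEquality using (_≡_)

record IsPartition (n : ℕ) (λs : List ℕ) : Set where
  field
    decreasing : Linked _≥_ λs
    positive   : All (λ p → 0 < p) λs
    total      : sum λs ≡ n

-- A filling is given by its list of rows (top row first).
Tableau : Set
Tableau = List (List ℕ)

shape : Tableau → List ℕ
shape = map length

-- the lower row r₂ lies under the upper row r₁ and is columnwise strictly larger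
ColStrict : List ℕ → List ℕ → Set
ColStrict _        []       = ⊤
ColStrict []       (_ ∷ _)  = ⊥
ColStrict (x ∷ xs) (y ∷ ys) = (x < y) × ColStrict xs ys

entries : Tableau → List ℕ
entries = concat

record SSYT (d : ℕ) (ν : List ℕ) (N : Tableau) : Set where
  field
    hasShape  : shape N ≡ ν
    rowsWeak  : All (Linked _≤_) N
    colStrict : Linked ColStrict N
    entrySum  : sum (entries N) ≡ d

maxEntry : Tableau → ℕ
maxEntry N = foldr _⊔_ 0 (entries N)

countAtLeast : ℕ → Tableau → ℕ
countAtLeast h N = length (filter (h ≤?_) (entries N))

-- Dsp^c(N) as a list (multiset): for h = 1, …, max entry (exactly the h ≥ 1
-- such that some entry is ≥ h), the number of entries ≥ h.
Dspc : Tableau → List ℕ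
Dspc N = map (λ h → countAtLeast h N) (map suc (upTo (maxEntry N)))

ιhat : Tableau → Tableau
ιhat []       = (0 ∷ []) ∷ []
ιhat (r ∷ rs) = (0 ∷ r) ∷ rs

{-# OPTIONS --safe #-}
module Submission where

-- Column strictness forces every entry below the first row to be positive.  So if
-- the first row began with a positive entry, all n + 1 entries would be positive;
-- hence it begins with 0.  Let ℓ + 1 be its length, k the number of its positive
-- entries and b the number of boxes below it.  Then 2(k + b) < n = ℓ + b gives
-- k + b < ℓ: after deleting the corner 0 the first row still has more than b zeros,
-- so it is at least as long as the second row and its zeros sit above all of it.
-- The number of positive entries is the head of Dsp^c(N) (or 0), and at most d.

open import Defs
open import Data.Nat using (ℕ; zero; suc; _+_; _*_; _⊔_; _<_; _≤_; _≥_; _≤?_; z≤n; s≤s)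
open import Data.Nat.Properties
open import Data.Nat.ListAction using (sum)
open import Data.List using (List; []; _∷_; _++_; length; filter; concat; map; foldr)
open import Data.List.Properties using (length-++; filter-++; filter-all; filter-none; foldr-forcesᵇ)
open import Data.List.Relation.Unary.All as All using (All; []; _∷_)
open import Data.List.Relation.Unary.All.Properties using (concat⁺)
open import Data.List.Relation.Unary.Linked as Linked using (Linked; [-]; _∷_)
open import Data.List.Relation.Unary.Linked.Properties using (Linked⇒All)
open import Data.Product using (_×_; _,_; ∃-syntax)
open import Data.Unit using (tt)
open import Data.Empty using (⊥-elim)
open import Function using (case_of_)
open import Relation.Binary.PropositionalEquality
  using (_≡_; refl; sym; trans; cong; subst; subst₂; module ≡-Reasoning)

length-concat : ∀ {A : Set} (xss : List (List A)) → length (concat xss) ≡ sum (map length xss)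
length-concat []         = refl
length-concat (xs ∷ xss) = trans (length-++ xs) (cong (length xs +_) (length-concat xss))

-- countAtLeast 1 N unfolds to positives (entries N).
positives : List ℕ → ℕ
positives xs = length (filter (1 ≤?_) xs)

positives-++ : ∀ xs ys → positives (xs ++ ys) ≡ positives xs + positives ys
positives-++ xs ys =
  trans (cong length (filter-++ (1 ≤?_) xs ys)) (length-++ (filter (1 ≤?_) xs))

positives-all : ∀ {xs} → All (0 <_) xs → positives xs ≡ length xs
positives-all all> = cong length (filter-all (1 ≤?_) all>)

positives-increasing : ∀ {x xs} → Linked _≤_ (suc x ∷ xs) →
                       positives (suc x ∷ xs) ≡ length (suc x ∷ xs)
positives-increasing row = positives-all (Linked⇒All ≤-trans (s≤s z≤n) row)

positives-none : ∀ {xs} → All (_≤ 0) xs → positives xs ≡ 0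
positives-none all≤ = cong length (filter-none (1 ≤?_) (All.map ≤⇒≯ all≤))

positives≤sum : ∀ xs → positives xs ≤ sum xs
positives≤sum []           = z≤n
positives≤sum (zero ∷ xs)  = positives≤sum xs
positives≤sum (suc x ∷ xs) = s≤s (≤-trans (positives≤sum xs) (m≤n+m (sum xs) x))

maximum≡0⇒all≤0 : ∀ xs → foldr _⊔_ 0 xs ≡ 0 → All (_≤ 0) xs
maximum≡0⇒all≤0 xs max≡0 =
  foldr-forcesᵇ (λ x y x⊔y≤0 → m⊔n≤o⇒m≤o x y x⊔y≤0 , m⊔n≤o⇒n≤o x y x⊔y≤0) 0 xs (≤-reflexive max≡0)

All-Dspc⇒countAtLeast1 : ∀ {P : ℕ → Set} N → P 0 → All P (Dspc N) → P (countAtLeast 1 N)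
All-Dspc⇒countAtLeast1 {P} N p0 allP with maxEntry N in max≡
... | zero = subst P (sym (positives-none (maximum≡0⇒all≤0 (entries N) max≡))) p0
... | suc _ with allP
...   | p1 ∷ _ = p1

colStrict-positive : ∀ xs ys → ColStrict xs ys → All (0 <_) ys
colStrict-positive _        []       _             = []
colStrict-positive (_ ∷ xs) (y ∷ ys) (x<y , below) =
  ≤-trans (s≤s z≤n) x<y ∷ colStrict-positive xs ys below

rows-below-positive : ∀ {r} rest → Linked ColStrict (r ∷ rest) → All (All (0 <_)) rest
rows-below-positive []         _            = []
rows-below-positive (s ∷ rest) (r<s ∷ cols) =
  colStrict-positive _ s r<s ∷ rows-below-positive rest cols

positives-entries : ∀ r rest → Linked ColStrict (r ∷ rest) →
                    positives (entries (r ∷ rest)) ≡ positives r + sum (shape rest)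
positives-entries r rest cols = begin
  positives (r ++ concat rest)           ≡⟨ positives-++ r (concat rest) ⟩
  positives r + positives (concat rest)  ≡⟨ cong (positives r +_) below ⟩
  positives r + sum (shape rest)         ∎
  where
    open ≡-Reasoning
    below : positives (concat rest) ≡ sum (shape rest)
    below = trans (positives-all (concat⁺ (rows-below-positive rest cols))) (length-concat rest)

colStrict-under-zeros : ∀ {xs ys} → Linked _≤_ xs → All (0 <_) ys →
                        length ys + positives xs ≤ length xs → ColStrict xs ys
colStrict-under-zeros {ys = []} _ _ _ = tt
colStrict-under-zeros {[]} {_ ∷ _} _ _ ()
colStrict-under-zeros {suc x ∷ xs} {_ ∷ ys} row _ fits =
  ⊥-elim (n≮n ℓ (≤-trans (s≤s (m≤n+m ℓ (length ys))) fits′))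
  where
    ℓ = length (suc x ∷ xs)
    fits′ : suc (length ys + ℓ) ≤ ℓ
    fits′ = subst (λ k → suc (length ys + k) ≤ ℓ) (positives-increasing row) fits
colStrict-under-zeros {zero ∷ xs} {_ ∷ ys} row (0<y ∷ pos) (s≤s fits) =
  0<y , colStrict-under-zeros (Linked.tail row) pos fits

colStrict-replace-first-row : ∀ {r₀ r} rest → Linked _≤_ r → Linked ColStrict (r₀ ∷ rest) →
                              sum (shape rest) + positives r ≤ length r → Linked ColStrict (r ∷ rest)
colStrict-replace-first-row []         _   _             _    = [-]
colStrict-replace-first-row (s ∷ rest) row (r₀<s ∷ cols) fits =
  colStrict-under-zeros row (colStrict-positive _ s r₀<s)
    (≤-trans (+-monoˡ-≤ _ (m≤m+n (length s) (sum (shape rest)))) fits) ∷ cols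

IsPartition-shorten-first : ∀ {n ℓ ls} → IsPartition (suc n) (suc ℓ ∷ ls) → sum ls < ℓ →
                            IsPartition n (ℓ ∷ ls)
IsPartition-shorten-first {ℓ = ℓ} {ls} P below<ℓ = record
  { decreasing = decreasing ls (IsPartition.decreasing P) below<ℓ
  ; positive   = ≤-trans (s≤s z≤n) below<ℓ ∷ All.tail (IsPartition.positive P)
  ; total      = suc-injective (IsPartition.total P)
  }
  where
    decreasing : ∀ ms → Linked _≥_ (suc ℓ ∷ ms) → sum ms < ℓ → Linked _≥_ (ℓ ∷ ms)
    decreasing []       _         _        = [-]
    decreasing (m ∷ ms) (_ ∷ dec) sum<ℓ = ≤-trans (m≤m+n m (sum ms)) (<⇒≤ sum<ℓ) ∷ dec

2*[k+b]<ℓ+b⇒k+b<ℓ : ∀ k b ℓ → 2 * (k + b) < ℓ + b → k + b < ℓ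
2*[k+b]<ℓ+b⇒k+b<ℓ k b ℓ bound = +-cancelʳ-< b (k + b) ℓ (≤-<-trans k+b+b≤2*[k+b] bound)
  where
    k+b+b≤2*[k+b] : k + b + b ≤ 2 * (k + b)
    k+b+b≤2*[k+b] = +-monoʳ-≤ (k + b) (≤-trans (m≤n+m b k) (≤-reflexive (sym (+-identityʳ (k + b)))))

ιhat-preimage : ∀ {n} N → IsPartition (suc n) (shape N) → All (Linked _≤_) N → Linked ColStrict N →
                2 * countAtLeast 1 N < n →
                ∃[ M ] (IsPartition n (shape M) × All (Linked _≤_) M × Linked ColStrict M × N ≡ ιhat M)
ιhat-preimage [] P _ _ _ = case IsPartition.total P of λ ()
ιhat-preimage ([] ∷ _) P _ _ _ = case IsPartition.positive P of λ { (() ∷ _) }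
ιhat-preimage {n} ((suc x ∷ r) ∷ rest) P (row ∷ _) cols few =
  ⊥-elim (<⇒≱ (subst (λ c → 2 * c < n) all-positive few) (≤-trans (n≤1+n n) (m≤n*m (suc n) 2)))
  where
    all-positive : countAtLeast 1 ((suc x ∷ r) ∷ rest) ≡ suc n
    all-positive = begin
      positives (entries ((suc x ∷ r) ∷ rest))  ≡⟨ positives-entries _ rest cols ⟩
      positives (suc x ∷ r) + sum (shape rest)  ≡⟨ cong (_+ sum (shape rest)) (positives-increasing row) ⟩
      sum (shape ((suc x ∷ r) ∷ rest))          ≡⟨ IsPartition.total P ⟩
      suc n                                     ∎
      where open ≡-Reasoning
ιhat-preimage {n} ((zero ∷ r) ∷ rest) P (row ∷ rows) cols few =
  r ∷ rest , IsPartition-shorten-first P (≤-<-trans (m≤n+m b k) k+b<ℓ) , Linked.tail row ∷ rows ,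
  colStrict-replace-first-row rest (Linked.tail row) cols
    (subst (_≤ length r) (+-comm k b) (<⇒≤ k+b<ℓ)) , refl
  where
    k = positives r
    b = sum (shape rest)
    k+b<ℓ : k + b < length r
    k+b<ℓ = 2*[k+b]<ℓ+b⇒k+b<ℓ k b (length r)
      (subst (λ m → 2 * (k + b) < m) (sym (suc-injective (IsPartition.total P)))
        (subst (λ c → 2 * c < n) (positives-entries (zero ∷ r) rest cols) few))

countAtLeast1≤sum : ∀ {d ν N} → SSYT d ν N → countAtLeast 1 N ≤ d
countAtLeast1≤sum {N = N} S = ≤-trans (positives≤sum (entries N)) (≤-reflexive (SSYT.entrySum S))

sum-entries-ιhat : ∀ M → sum (entries (ιhat M)) ≡ sum (entries M)
sum-entries-ιhat []      = refl
sum-entries-ιhat (_ ∷ _) = refl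

SSYT-ιhat-preimage : ∀ {n d ν N} → IsPartition (n + 1) ν → SSYT d ν N → 2 * countAtLeast 1 N < n →
                     ∃[ λs ] ∃[ M ] (IsPartition n λs × SSYT d λs M × N ≡ ιhat M)
SSYT-ιhat-preimage {n} {N = N} P S few
  with ιhat-preimage N (subst₂ IsPartition (+-comm n 1) (sym (SSYT.hasShape S)) P)
                     (SSYT.rowsWeak S) (SSYT.colStrict S) few
... | M , partition , rows , cols , refl = shape M , M , partition , record
  { hasShape  = refl
  ; rowsWeak  = rows
  ; colStrict = cols
  ; entrySum  = trans (sym (sum-entries-ιhat M)) (SSYT.entrySum S)
  } , refl

corollary3p18 : (n d : ℕ) → 1 ≤ n →
    ((ν : List ℕ) → IsPartition (n + 1) ν → (N : Tableau) → SSYT d ν N →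
      All (λ i → 2 * i < n) (Dspc N) →
      ∃[ λs ] ∃[ M ] (IsPartition n λs × SSYT d λs M × N ≡ ιhat M))
    × (2 * d < n →
      (ν : List ℕ) → IsPartition (n + 1) ν → (N : Tableau) → SSYT d ν N →
      ∃[ λs ] ∃[ M ] (IsPartition n λs × SSYT d λs M × N ≡ ιhat M))
corollary3p18 n d 0<n =
  (λ ν P N S bounded → SSYT-ιhat-preimage P S (All-Dspc⇒countAtLeast1 N 0<n bounded)) ,
  (λ 2d<n ν P N S → SSYT-ιhat-preimage P S (≤-<-trans (*-monoʳ-≤ 2 (countAtLeast1≤sum S)) 2d<n))
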